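{- Let $m>1$ be an odd integer, and let $c_m$ be the integer such that $I_r(\mathbb{Z}/m \mathbb{Z})=\mathsf{D}((\mathbb{Z}/m \mathbb{Z})^{\times})+\Omega(m)-\omega(m)+c_m$. Then $$I_r(\mathbb{Z}/2m \mathbb{Z})=\mathsf{D}((\mathbb{Z}/2m \mathbb{Z})^{\times})+\Omega(2m)-\omega(2m)+c_m.$$
   Context: For a finite commutative ring $R$, $I_r(R)$ is the smallest positive integer $t$ such that every sequence of $t$ (not necessarily distinct) elements of $R$ contains a nonempty subsequence whose elements multiply to an idempotent element of $R$ (an element $x$ with $x^2=x$). For a finite abelian group $G$, $\mathsf{D}(G)$ (Davenport constant) is the smallest positive integer $t$ such that every sequence of $t$ elements of $G$ contains a nonempty subsequence whose elements multiply to the identity. For an integer $n>1$, $\Omega(n)$ is the number of prime factors of $n$ counted with multiplicity and $\omega(n)$ is the number of distinct prime divisors of $n$. -}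

module Defs where

open import Data.Nat using (ℕ; zero; suc; _*_; _<_)
open import Data.Nat.Properties using (_≟_)
open import Data.Nat.Coprimality using (Coprime)
open import Data.Nat.Primality.Factorisation using (factorise; factors)
open import Data.Fin using (Fin; toℕ)
open import Data.Fin.Subset using (Subset; Side; inside; outside; Nonempty)
open import Data.Vec using (Vec; []; _∷_; map)
open import Data.Vec.Relation.Unary.All using (All)
open import Data.List using (length; deduplicate)
open import Data.Integer using (ℤ; +_; _-_)
open import Data.Integer.Divisibility using (_∣_)
open import Data.Product using (∃; _×_)
open import Relation.Nullary using (¬_)

-- Elements of ℤ/nℤ are represented by Fin n (residues 0..n-1).
-- Congruence modulo n:  a ≡ b (mod n)  iff  n ∣ a - b  (in ℤ).
_≡_[mod_] : ℕ → ℕ → ℕ → Set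
a ≡ b [mod n ] = (+ n) ∣ (+ a - + b)

selProd : ∀ {t} → Vec ℕ t → Subset t → ℕ
selProd [] [] = 1
selProd (x ∷ xs) (inside ∷ p) = x * selProd xs p
selProd (x ∷ xs) (outside ∷ p) = selProd xs p

IsIdempotent : ℕ → ℕ → Set
IsIdempotent n x = (x * x) ≡ x [mod n ]

IrProperty : ℕ → ℕ → Set
IrProperty n t = (s : Vec (Fin n) t) →
  ∃ λ (p : Subset t) → Nonempty p × IsIdempotent n (selProd (map toℕ s) p)

IsIr : ℕ → ℕ → Set
IsIr n t = 0 < t × IrProperty n t × (∀ t' → 0 < t' → t' < t → ¬ IrProperty n t')

IsUnit : (n : ℕ) → Fin n → Set
IsUnit n x = Coprime (toℕ x) n

DProperty : ℕ → ℕ → Set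
DProperty n t = (s : Vec (Fin n) t) → All (IsUnit n) s →
  ∃ λ (p : Subset t) → Nonempty p × (selProd (map toℕ s) p ≡ 1 [mod n ])

IsDavenportUnits : ℕ → ℕ → Set
IsDavenportUnits n t = 0 < t × DProperty n t × (∀ t' → 0 < t' → t' < t → ¬ DProperty n t')

-- Ω(n): number of prime factors counted with multiplicity (Ω 0 is junk = 0)
Ω : ℕ → ℕ
Ω zero = 0
Ω (suc k) = length (factors (factorise (suc k)))

-- ω(n): number of distinct prime divisors (ω 0 is junk = 0)
ω : ℕ → ℕ
ω zero = 0
ω (suc k) = length (deduplicate _≟_ (factors (factorise (suc k))))

-- For odd m, ℤ/2mℤ ≅ ℤ/2ℤ × ℤ/mℤ. Every residue modulo 2 is idempotent and every unit modulo 2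
-- is 1, so a product of residues modulo 2m is idempotent exactly when it is idempotent modulo m,
-- and a product of units modulo 2m (which are odd) is 1 exactly when it is 1 modulo m. Reducing
-- sequences modulo m, and lifting them back (a unit x modulo m lifts to whichever of x and m + x
-- is odd), therefore carries the witnessing subsequences back and forth, so I_r and D take the
-- same value at m and at 2m. Meanwhile 2 is a new prime factor of 2m, so Ω and ω both grow by
-- exactly one, and the same constant c_m works for 2m.

module Submission where

open import Data.Fin using (Fin; toℕ; inject≤; _↑ˡ_; _↑ʳ_)
open import Data.Fin.Properties using (toℕ-fromℕ<; toℕ-inject≤; toℕ-↑ˡ; toℕ-↑ʳ)
open import Data.Fin.Subset using (inside; outside)
open import Data.Integer using (ℤ; +_; _+_; _-_; -_)
import Data.Integer as ℤ
import Data.Integer.Divisibility.Signed as Signed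
import Data.Integer.Properties as ℤ
open import Data.Integer.Tactic.RingSolver using (solve-∀)
open import Data.List using (List; _∷_; [_]; deduplicate)
open import Data.List.Membership.Propositional using (_∈_)
open import Data.List.Membership.Propositional.Properties using (deduplicate-∈⇔)
open import Data.List.Membership.Propositional.Properties.WithK using (unique∧set⇒bag)
open import Data.List.Relation.Binary.BagAndSetEquality using (∼bag⇒↭)
open import Data.List.Relation.Binary.Disjoint.Propositional using (Disjoint)
open import Data.List.Relation.Binary.Permutation.Propositional using (_↭_; ↭-sym; ↭-trans)
open import Data.List.Relation.Binary.Permutation.Propositional.Properties using (↭-length; ∈-resp-↭)
open import Data.List.Relation.Binary.Permutation.Propositional.Properties.WithK using (dedup-++-↭)
open import Data.List.Relation.Unary.Any using (here)
open import Data.List.Relation.Unary.All using () renaming (_∷_ to _∷ᴸ_)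
open import Data.Nat using (ℕ; suc; NonZero; _<_; _*_; s≤s)
import Data.Nat as ℕ
import Data.Nat.Properties as ℕ
open import Data.List.Relation.Unary.Unique.DecPropositional.Properties ℕ._≟_ using (deduplicate-!)
open import Data.Nat.Coprimality using (Coprime; coprime-divisor; coprime-+) renaming (sym to coprime-sym)
open import Data.Nat.Divisibility
  using (_∣_; divides; _∣?_; m%n≡0⇒n∣m; ∣-trans; ∣⇒≤; m∣m*n; n∣m*n; ∣m+n∣m⇒∣n; ∣n∣m%n⇒∣m; *-monoˡ-∣)
open import Data.Nat.DivMod using (_%_; _/_; _mod_; m≡m%n+[m/n]*n; m%n<n)
open import Data.Nat.ListAction.Properties using (∈⇒∣product)
open import Data.Nat.Primality using (Prime; prime[2]; prime⇒irreducible)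
open import Data.Nat.Primality.Factorisation
  using (PrimeFactorisation; factorise; factors; factorisationUnique)
open import Data.Product using (Σ; _×_; _,_)
open import Data.Sum using (inj₁; inj₂)
open import Data.Vec using (Vec; []; _∷_; map)
open import Data.Vec.Properties using (map-∘; map-cong)
open import Data.Vec.Relation.Binary.Pointwise.Inductive using (Pointwise; []; _∷_)
open import Data.Vec.Relation.Unary.All using (All; []; _∷_)
import Data.Vec.Relation.Unary.All as All
import Data.Vec.Relation.Unary.All.Properties as All
open import Function.Base using (_∘_)
open import Function.Bundles using (_⇔_; mk⇔; Equivalence)
open import Relation.Binary.Definitions using (tri<; tri≈; tri>)
open import Relation.Binary.PropositionalEquality using (_≡_; refl; sym; trans; cong; subst; subst₂; cong₂; module ≡-Reasoning)
open import Relation.Nullary using (¬_; yes; no; contradiction)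

open import Defs

prime∤⇒coprime : ∀ {p n} → Prime p → ¬ p ∣ n → Coprime p n
prime∤⇒coprime p-prime p∤n (d∣p , d∣n) with prime⇒irreducible p-prime d∣p
... | inj₁ d≡1  = d≡1
... | inj₂ refl = contradiction d∣n p∤n

coprime-* : ∀ {a m n} → Coprime a m → Coprime a n → Coprime a (m * n)
coprime-* {a} {m} a⊥m a⊥n {d} (d∣a , d∣m*n) = a⊥n (d∣a , coprime-divisor d⊥m d∣m*n)
  where
  d⊥m : Coprime d m
  d⊥m (e∣d , e∣m) = a⊥m (∣-trans e∣d d∣a , e∣m)

coprime-% : ∀ {a n N} .{{_ : NonZero n}} → n ∣ N → Coprime a N → Coprime (a % n) n
coprime-% n∣N a⊥N (d∣a%n , d∣n) = a⊥N (∣n∣m%n⇒∣m d∣n d∣a%n , ∣-trans d∣n n∣N)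

coprime[a,2*m]⇒2∤a : ∀ {a m} → Coprime a (2 * m) → ¬ 2 ∣ a
coprime[a,2*m]⇒2∤a {m = m} a⊥2m 2∣a with a⊥2m (2∣a , m∣m*n m)
... | ()

coprime⇒*∣ : ∀ {m n o} → Coprime m n → m ∣ o → n ∣ o → m * n ∣ o
coprime⇒*∣ {m} {n} m⊥n m∣o (divides k refl) =
  *-monoˡ-∣ n (coprime-divisor m⊥n (subst (m ∣_) (ℕ.*-comm k n) m∣o))

2∤∧coprime⇒coprime[2*] : ∀ {a m} → ¬ 2 ∣ a → Coprime a m → Coprime a (2 * m)
2∤∧coprime⇒coprime[2*] 2∤a a⊥m = coprime-* (coprime-sym (prime∤⇒coprime prime[2] 2∤a)) a⊥m

infix 4 _≅_[mod_]

record _≅_[mod_] (x y : ℤ) (n : ℕ) : Set where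
  constructor mk≅
  field modulus∣difference : + n Signed.∣ x - y

[mod]⇒≅ : ∀ {a b n} → a ≡ b [mod n ] → + a ≅ + b [mod n ]
[mod]⇒≅ a≡b = mk≅ (Signed.∣ᵤ⇒∣ a≡b)

≅⇒[mod] : ∀ {a b n} → + a ≅ + b [mod n ] → a ≡ b [mod n ]
≅⇒[mod] (mk≅ n∣a-b) = Signed.∣⇒∣ᵤ n∣a-b

module _ {n : ℕ} where

  ≅-refl : ∀ {x} → x ≅ x [mod n ]
  ≅-refl {x} = mk≅ (Signed.divides (+ 0) (ℤ.+-inverseʳ x))

  ≅-sym : ∀ {x y} → x ≅ y [mod n ] → y ≅ x [mod n ]
  ≅-sym {x} {y} (mk≅ n∣x-y) =
    mk≅ (subst (+ n Signed.∣_) (negate-difference x y) (Signed.∣m⇒∣-m n∣x-y))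
    where
    negate-difference : ∀ x y → - (x - y) ≡ y - x
    negate-difference = solve-∀

  ≅-trans : ∀ {x y z} → x ≅ y [mod n ] → y ≅ z [mod n ] → x ≅ z [mod n ]
  ≅-trans {x} {y} {z} (mk≅ n∣x-y) (mk≅ n∣y-z) =
    mk≅ (subst (+ n Signed.∣_) (telescope x y z) (Signed.∣m∣n⇒∣m+n n∣x-y n∣y-z))
    where
    telescope : ∀ x y z → (x - y) + (y - z) ≡ x - z
    telescope = solve-∀

  ≅-*-cong : ∀ {x y u v} → x ≅ y [mod n ] → u ≅ v [mod n ] → x ℤ.* u ≅ y ℤ.* v [mod n ]
  ≅-*-cong {x} {y} {u} {v} (mk≅ n∣x-y) (mk≅ n∣u-v) =
    mk≅ (subst (+ n Signed.∣_) (split x y u v)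
      (Signed.∣m∣n⇒∣m+n (Signed.∣n⇒∣m*n x n∣u-v) (Signed.∣m⇒∣m*n v n∣x-y)))
    where
    split : ∀ x y u v → x ℤ.* (u - v) + (x - y) ℤ.* v ≡ x ℤ.* u - y ℤ.* v
    split = solve-∀

  ≅-+-multiple : ∀ {k x} → + n Signed.∣ k → k + x ≅ x [mod n ]
  ≅-+-multiple {k} {x} n∣k = mk≅ (subst (+ n Signed.∣_) (sym (cancel k x)) n∣k)
    where
    cancel : ∀ k x → (k + x) - x ≡ k
    cancel = solve-∀

≅-pos-*-cong : ∀ {n a b c d} → + a ≅ + b [mod n ] → + c ≅ + d [mod n ]
  → + (a * c) ≅ + (b * d) [mod n ]
≅-pos-*-cong {n} {a} {b} {c} {d} a≅b c≅d =
  subst₂ (_≅_[mod n ]) (sym (ℤ.pos-* a c)) (sym (ℤ.pos-* b d)) (≅-*-cong a≅b c≅d)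

≅-mod-divisor : ∀ {d n x y} → d ∣ n → x ≅ y [mod n ] → x ≅ y [mod d ]
≅-mod-divisor d∣n (mk≅ n∣x-y) = mk≅ (Signed.∣-trans (Signed.∣ᵤ⇒∣ d∣n) n∣x-y)

≅-mod-* : ∀ {m n x y} → Coprime m n → x ≅ y [mod m ] → x ≅ y [mod n ] → x ≅ y [mod m * n ]
≅-mod-* m⊥n (mk≅ m∣x-y) (mk≅ n∣x-y) =
  mk≅ (Signed.∣ᵤ⇒∣ (coprime⇒*∣ m⊥n (Signed.∣⇒∣ᵤ m∣x-y) (Signed.∣⇒∣ᵤ n∣x-y)))

≅-% : ∀ a n .{{_ : NonZero n}} → + a ≅ + (a % n) [mod n ]
≅-% a n = subst (λ x → x ≅ + (a % n) [mod n ]) (cong +_ a≡[a/n]*n+a%n)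
  (≅-+-multiple {k = + (a / n * n)} (Signed.∣ᵤ⇒∣ (n∣m*n (a / n))))
  where
  a≡[a/n]*n+a%n : a / n * n ℕ.+ a % n ≡ a
  a≡[a/n]*n+a%n = trans (ℕ.+-comm (a / n * n) (a % n)) (sym (m≡m%n+[m/n]*n a n))

∣⇒≅0 : ∀ {d a} → d ∣ a → + a ≅ + 0 [mod d ]
∣⇒≅0 {d} {a} d∣a = mk≅ (subst (+ d Signed.∣_) (sym (ℤ.+-identityʳ (+ a))) (Signed.∣ᵤ⇒∣ d∣a))

2∤⇒%2≡1 : ∀ a → ¬ 2 ∣ a → a % 2 ≡ 1
2∤⇒%2≡1 a 2∤a with a % 2 | m%n<n a 2 | m%n≡0⇒n∣m a 2
... | 0           | _            | 2∣a = contradiction (2∣a refl) 2∤a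
... | 1           | _            | _   = refl
... | suc (suc _) | s≤s (s≤s ()) | _

2∤⇒≅1 : ∀ {a} → ¬ 2 ∣ a → + a ≅ + 1 [mod 2 ]
2∤⇒≅1 {a} 2∤a = subst (λ r → + a ≅ + r [mod 2 ]) (2∤⇒%2≡1 a 2∤a) (≅-% a 2)

square≅[mod2] : ∀ a → + (a * a) ≅ + a [mod 2 ]
square≅[mod2] a with 2 ∣? a
... | yes 2∣a = ≅-trans (∣⇒≅0 (∣-trans 2∣a (m∣m*n a))) (≅-sym (∣⇒≅0 2∣a))
... | no 2∤a = ≅-trans (≅-pos-*-cong a≅1 a≅1) (≅-sym a≅1)
  where
  a≅1 : + a ≅ + 1 [mod 2 ]
  a≅1 = 2∤⇒≅1 2∤a

infix 4 _≋_[mod_]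

_≋_[mod_] : ∀ {t} → Vec ℕ t → Vec ℕ t → ℕ → Set
u ≋ v [mod n ] = Pointwise (λ a b → + a ≅ + b [mod n ]) u v

selProd-cong : ∀ {n t} {u v : Vec ℕ t} → u ≋ v [mod n ]
  → ∀ p → + selProd u p ≅ + selProd v p [mod n ]
selProd-cong []            []           = ≅-refl
selProd-cong (a≅b ∷ u≋v) (inside ∷ p)  = ≅-pos-*-cong a≅b (selProd-cong u≋v p)
selProd-cong (_   ∷ u≋v) (outside ∷ p) = selProd-cong u≋v p

selProd-≅1 : ∀ {n t} {u : Vec ℕ t} → All (λ a → + a ≅ + 1 [mod n ]) u
  → ∀ p → + selProd u p ≅ + 1 [mod n ]
selProd-≅1 []            []           = ≅-refl
selProd-≅1 (a≅1 ∷ u≅1) (inside ∷ p)  = ≅-pos-*-cong a≅1 (selProd-≅1 u≅1 p)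
selProd-≅1 (_   ∷ u≅1) (outside ∷ p) = selProd-≅1 u≅1 p

isIdempotent-resp-≅ : ∀ {n a b} → + a ≅ + b [mod n ] → IsIdempotent n b → IsIdempotent n a
isIdempotent-resp-≅ a≅b b²≡b =
  ≅⇒[mod] (≅-trans (≅-pos-*-cong a≅b a≅b) (≅-trans ([mod]⇒≅ b²≡b) (≅-sym a≅b)))

isIdempotent-divisor : ∀ {d n} → d ∣ n → ∀ a → IsIdempotent n a → IsIdempotent d a
isIdempotent-divisor d∣n a idem = ≅⇒[mod] (≅-mod-divisor d∣n ([mod]⇒≅ {a * a} {a} idem))

isIdempotent[2*m]⇔isIdempotent[m] : ∀ {m} → ¬ 2 ∣ m
  → ∀ a → IsIdempotent (2 * m) a ⇔ IsIdempotent m a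
isIdempotent[2*m]⇔isIdempotent[m] 2∤m a = mk⇔ (isIdempotent-divisor (n∣m*n 2) a) λ idem →
  ≅⇒[mod] (≅-mod-* (prime∤⇒coprime prime[2] 2∤m) (square≅[mod2] a) ([mod]⇒≅ {a * a} {a} idem))

reduce : ∀ {N t} n .{{_ : NonZero n}} → Vec (Fin N) t → Vec (Fin n) t
reduce n = map (λ x → toℕ x mod n)

module _ {n : ℕ} .{{_ : NonZero n}} where

  toℕ-mod : ∀ a → toℕ (a mod n) ≡ a % n
  toℕ-mod a = toℕ-fromℕ< (m%n<n a n)

  toℕ-mod-≅ : ∀ a → + a ≅ + toℕ (a mod n) [mod n ]
  toℕ-mod-≅ a = subst (λ r → + a ≅ + r [mod n ]) (sym (toℕ-mod a)) (≅-% a n)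

  reduce-≋ : ∀ {N t} (s : Vec (Fin N) t) → map toℕ s ≋ map toℕ (reduce n s) [mod n ]
  reduce-≋ []      = []
  reduce-≋ (x ∷ s) = toℕ-mod-≅ (toℕ x) ∷ reduce-≋ s

  reduce-units : ∀ {N t} {s : Vec (Fin N) t} → n ∣ N
    → All (IsUnit N) s → All (IsUnit n) (reduce n s)
  reduce-units n∣N [] = []
  reduce-units {s = x ∷ _} n∣N (x⊥N ∷ s⊥N) =
    subst (λ r → Coprime r n) (sym (toℕ-mod (toℕ x))) (coprime-% n∣N x⊥N) ∷ reduce-units n∣N s⊥N

units[2*m]≅1[mod2] : ∀ {m t} {s : Vec (Fin (2 * m)) t}
  → All (IsUnit (2 * m)) s → All (λ a → + a ≅ + 1 [mod 2 ]) (map toℕ s)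
units[2*m]≅1[mod2] {m} s⊥2m = All.map⁺ (All.map (2∤⇒≅1 ∘ coprime[a,2*m]⇒2∤a {m = m}) s⊥2m)

-- Fin (2 * m) computes to Fin (m + (m + 0)), so x : Fin m embeds in it both as x and as m + x.
liftUnit : ∀ {m} → ¬ 2 ∣ m → (x : Fin m) → IsUnit m x
  → Σ (Fin (2 * m)) λ y → IsUnit (2 * m) y × + toℕ y ≅ + toℕ x [mod m ]
liftUnit {m} 2∤m x x⊥m with 2 ∣? toℕ x
... | no 2∤x  = x ↑ˡ (m ℕ.+ 0)
              , subst (λ r → Coprime r (2 * m)) (sym x≡x) (2∤∧coprime⇒coprime[2*] 2∤x x⊥m)
              , subst (λ r → + r ≅ + toℕ x [mod m ]) (sym x≡x) ≅-refl
  where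
  x≡x : toℕ (x ↑ˡ (m ℕ.+ 0)) ≡ toℕ x
  x≡x = toℕ-↑ˡ x _
... | yes 2∣x = m ↑ʳ (x ↑ˡ 0)
              , subst (λ r → Coprime r (2 * m)) (sym m+x≡m+x)
                  (2∤∧coprime⇒coprime[2*] 2∤m+x (coprime-+ x⊥m))
              , subst (λ r → + r ≅ + toℕ x [mod m ]) (sym m+x≡m+x) (≅-+-multiple Signed.∣-refl)
  where
  m+x≡m+x : toℕ (m ↑ʳ (x ↑ˡ 0)) ≡ m ℕ.+ toℕ x
  m+x≡m+x = trans (toℕ-↑ʳ m _) (cong (m ℕ.+_) (toℕ-↑ˡ x 0))
  2∤m+x : ¬ 2 ∣ m ℕ.+ toℕ x
  2∤m+x 2∣m+x = 2∤m (∣m+n∣m⇒∣n (subst (2 ∣_) (ℕ.+-comm m (toℕ x)) 2∣m+x) 2∣x)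

liftUnits : ∀ {m t} → ¬ 2 ∣ m → {s : Vec (Fin m) t} → All (IsUnit m) s
  → Σ (Vec (Fin (2 * m)) t) λ s′ → All (IsUnit (2 * m)) s′ × map toℕ s′ ≋ map toℕ s [mod m ]
liftUnits 2∤m [] = [] , [] , []
liftUnits 2∤m {x ∷ _} (x⊥m ∷ s⊥m) with liftUnit 2∤m x x⊥m | liftUnits 2∤m s⊥m
... | y , y⊥2m , y≅x | s′ , s′⊥2m , s′≋s = y ∷ s′ , y⊥2m ∷ s′⊥2m , y≅x ∷ s′≋s

irProperty-divisor : ∀ {m N t} .{{_ : NonZero N}} → m ∣ N → IrProperty N t → IrProperty m t
irProperty-divisor {m} {N} m∣N ir s with ir (map (λ x → inject≤ x (∣⇒≤ m∣N)) s)
... | p , p≢∅ , idem = p , p≢∅ , isIdempotent-divisor m∣N (selProd (map toℕ s) p)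
  (subst (λ v → IsIdempotent N (selProd v p)) toℕ-inject idem)
  where
  toℕ-inject : map toℕ (map (λ x → inject≤ x (∣⇒≤ m∣N)) s) ≡ map toℕ s
  toℕ-inject = trans (sym (map-∘ toℕ _ s)) (map-cong (λ x → toℕ-inject≤ x _) s)

module _ {m : ℕ} .{{_ : NonZero m}} (2∤m : ¬ 2 ∣ m) where

  irProperty[m]⇒irProperty[2*m] : ∀ {t} → IrProperty m t → IrProperty (2 * m) t
  irProperty[m]⇒irProperty[2*m] ir s with ir (reduce m s)
  ... | p , p≢∅ , idem = p , p≢∅ ,
    Equivalence.from (isIdempotent[2*m]⇔isIdempotent[m] 2∤m (selProd (map toℕ s) p))
      (isIdempotent-resp-≅ (selProd-cong (reduce-≋ s) p) idem)

  dProperty[m]⇒dProperty[2*m] : ∀ {t} → DProperty m t → DProperty (2 * m) t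
  dProperty[m]⇒dProperty[2*m] d s s⊥2m with d (reduce m s) (reduce-units (n∣m*n 2) s⊥2m)
  ... | p , p≢∅ , prod≡1 = p , p≢∅ , ≅⇒[mod] (≅-mod-* {2} {m} (prime∤⇒coprime prime[2] 2∤m)
    (selProd-≅1 (units[2*m]≅1[mod2] {m} s⊥2m) p)
    (≅-trans (selProd-cong (reduce-≋ s) p) ([mod]⇒≅ {b = 1} prod≡1)))

  dProperty[2*m]⇒dProperty[m] : ∀ {t} → DProperty (2 * m) t → DProperty m t
  dProperty[2*m]⇒dProperty[m] d s s⊥m with liftUnits 2∤m s⊥m
  ... | s′ , s′⊥2m , s′≋s with d s′ s′⊥2m
  ... | p , p≢∅ , prod≡1 = p , p≢∅ ,
    ≅⇒[mod] (≅-trans (≅-sym (selProd-cong s′≋s p))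
      (≅-mod-divisor (n∣m*n 2) ([mod]⇒≅ {selProd (map toℕ s′) p} {1} prod≡1)))

  irProperty[2*m]⇔irProperty[m] : ∀ {t} → IrProperty (2 * m) t ⇔ IrProperty m t
  irProperty[2*m]⇔irProperty[m] =
    mk⇔ (irProperty-divisor {{ℕ.m*n≢0 2 m}} (n∣m*n 2)) irProperty[m]⇒irProperty[2*m]

  dProperty[2*m]⇔dProperty[m] : ∀ {t} → DProperty (2 * m) t ⇔ DProperty m t
  dProperty[2*m]⇔dProperty[m] = mk⇔ dProperty[2*m]⇒dProperty[m] dProperty[m]⇒dProperty[2*m]

LeastPositive : (ℕ → Set) → ℕ → Set
LeastPositive P t = 0 < t × P t × (∀ t′ → 0 < t′ → t′ < t → ¬ P t′)

leastPositive-unique : ∀ {P Q : ℕ → Set} {a b} → (∀ {t} → P t ⇔ Q t)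
  → LeastPositive P a → LeastPositive Q b → a ≡ b
leastPositive-unique {a = a} {b} P⇔Q (0<a , Pa , a-least) (0<b , Qb , b-least) with ℕ.<-cmp a b
... | tri< a<b _ _ = contradiction (Equivalence.to P⇔Q Pa) (b-least a 0<a a<b)
... | tri≈ _ a≡b _ = a≡b
... | tri> _ _ b<a = contradiction (Equivalence.from P⇔Q Qb) (a-least b 0<b b<a)

2∷factorisation : ∀ {n} → PrimeFactorisation n → PrimeFactorisation (2 * n)
2∷factorisation f = record
  { factors         = 2 ∷ factors f
  ; isFactorisation = cong (2 *_) (PrimeFactorisation.isFactorisation f)
  ; factorsPrime    = prime[2] ∷ᴸ PrimeFactorisation.factorsPrime f
  }

factors[2*n]↭2∷factors[n] : ∀ n .{{_ : NonZero n}}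
  → factors (factorise (2 * n) {{ℕ.m*n≢0 2 n}}) ↭ 2 ∷ factors (factorise n)
factors[2*n]↭2∷factors[n] n =
  factorisationUnique (factorise (2 * n) {{ℕ.m*n≢0 2 n}}) (2∷factorisation (factorise n))

Ω[2*n]≡1+Ω[n] : ∀ n .{{_ : NonZero n}} → Ω (2 * n) ≡ suc (Ω n)
Ω[2*n]≡1+Ω[n] n@(suc _) = ↭-length (factors[2*n]↭2∷factors[n] n)

deduplicate-↭ : ∀ {xs ys : List ℕ} → xs ↭ ys → deduplicate ℕ._≟_ xs ↭ deduplicate ℕ._≟_ ys
deduplicate-↭ {xs} {ys} xs↭ys =
  ∼bag⇒↭ (unique∧set⇒bag (deduplicate-! xs) (deduplicate-! ys) (mk⇔ (move xs↭ys) (move (↭-sym xs↭ys))))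
  where
  move : ∀ {us vs z} → us ↭ vs → z ∈ deduplicate ℕ._≟_ us → z ∈ deduplicate ℕ._≟_ vs
  move us↭vs =
    Equivalence.to (deduplicate-∈⇔ ℕ._≟_) ∘ ∈-resp-↭ us↭vs ∘ Equivalence.from (deduplicate-∈⇔ ℕ._≟_)

ω[2*n]≡1+ω[n] : ∀ n .{{_ : NonZero n}} → ¬ 2 ∣ n → ω (2 * n) ≡ suc (ω n)
ω[2*n]≡1+ω[n] n@(suc _) 2∤n =
  ↭-length (↭-trans (deduplicate-↭ (factors[2*n]↭2∷factors[n] n)) (dedup-++-↭ ℕ._≟_ 2∉factors))
  where
  2∉factors : Disjoint [ 2 ] (factors (factorise n))
  2∉factors (here refl , 2∈fs) =
    2∤n (subst (2 ∣_) (sym (PrimeFactorisation.isFactorisation (factorise n))) (∈⇒∣product 2∈fs))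

corollary3p1 : (m : ℕ) → 1 < m → ¬ (2 ∣ m) → (c : ℤ)
    → (i₁ d₁ i₂ d₂ : ℕ)
    → IsIr m i₁ → IsDavenportUnits m d₁
    → IsIr (2 * m) i₂ → IsDavenportUnits (2 * m) d₂
    → + i₁ ≡ + d₁ + + Ω m - + ω m + c
    → + i₂ ≡ + d₂ + + Ω (2 * m) - + ω (2 * m) + c
corollary3p1 m@(suc _) _ 2∤m c i₁ d₁ i₂ d₂ I₁ D₁ I₂ D₂ i₁≡ = begin
  + i₂                                  ≡⟨ cong +_ i₂≡i₁ ⟩
  + i₁                                  ≡⟨ i₁≡ ⟩
  + d₁ + + Ω m - + ω m + c              ≡⟨ one-more-each (+ d₁) (+ Ω m) (+ ω m) c ⟩
  + d₁ + + suc (Ω m) - + suc (ω m) + c  ≡⟨ cong₂ (λ x y → + d₁ + + x - + y + c) Ω≡ ω≡ ⟩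
  + d₁ + + Ω (2 * m) - + ω (2 * m) + c  ≡⟨ cong (λ d → + d + + Ω (2 * m) - + ω (2 * m) + c) d₁≡d₂ ⟩
  + d₂ + + Ω (2 * m) - + ω (2 * m) + c  ∎
  where
  open ≡-Reasoning
  i₂≡i₁ : i₂ ≡ i₁
  i₂≡i₁ = leastPositive-unique (irProperty[2*m]⇔irProperty[m] 2∤m) I₂ I₁
  d₁≡d₂ : d₁ ≡ d₂
  d₁≡d₂ = sym (leastPositive-unique (dProperty[2*m]⇔dProperty[m] 2∤m) D₂ D₁)
  Ω≡ : suc (Ω m) ≡ Ω (2 * m)
  Ω≡ = sym (Ω[2*n]≡1+Ω[n] m)
  ω≡ : suc (ω m) ≡ ω (2 * m)
  ω≡ = sym (ω[2*n]≡1+ω[n] m 2∤m)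
  one-more-each : ∀ d x y c → d + x - y + c ≡ d + (+ 1 + x) - (+ 1 + y) + c
  one-more-each = solve-∀
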